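{- Let $\boldsymbol{\alpha}=(\alpha_i)_{i\in\mathbb{Z}}$ be commuting indeterminates and define $A^k_{ij}\in\mathbb{Z}[\boldsymbol{\alpha}]$ for $i,j,k\in\mathbb{Z}$ as below. Then for all integers $k,\ell>0$ and all $p,q\in\mathbb{Z}$, \[ \sum_{a \in \mathbb{Z}} A_{p, a}^k A_{a,q}^{\ell} = A_{p,q}^{k+\ell}, \] where the sum has only finitely many nonzero terms.
   Context: For $i,j,k\in\mathbb{Z}$ set \[ A_{ij}^k = \begin{cases} e_{j-i-k}(-\alpha_{i+1},\dots,-\alpha_{j-1}) & \text{if } j \geqslant i + k \text{ and } k > 0, \\ h_{j-i-k}(\alpha_j,\dots,\alpha_i) & \text{if } j \leqslant i \leqslant j - k \text{ and } k \leqslant 0, \\ 0 & \text{otherwise,} \end{cases} \] where $e_r,h_r$ are the elementary and complete homogeneous symmetric polynomials in the listed variables, with $e_0=h_0=1$ and $e_r$ of an empty list equal to $0$ for $r>0$. -}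

module Defs where

open import Level using (Level)
open import Algebra.Bundles using (CommutativeRing)
open import Data.Nat as ℕ using (ℕ; zero; suc)
open import Data.Integer as ℤ using (ℤ; +_; ∣_∣; _≤?_; _<?_)
open import Data.List using (List; []; _∷_; map; foldr)
open import Relation.Nullary using (yes; no)

range : ℤ → ℕ → List ℤ
range a zero    = []
range a (suc n) = a ∷ range (a ℤ.+ + 1) n

module Symm {c ℓ : Level} (R : CommutativeRing c ℓ) where
  open CommutativeRing R

  e : ℕ → List Carrier → Carrier
  e zero    _        = 1#
  e (suc r) []       = 0#
  e (suc r) (x ∷ xs) = e (suc r) xs + x * e r xs

  h : ℕ → List Carrier → Carrier
  h zero    _        = 1#
  h (suc r) []       = 0#
  h (suc r) (x ∷ xs) = h (suc r) xs + x * h r (x ∷ xs)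

  sumOver : List ℤ → (ℤ → Carrier) → Carrier
  sumOver as f = foldr (λ a s → f a + s) 0# as

  -- A^k_{ij}, evaluated at an assignment α : ℤ → Carrier of the indeterminates
  module _ (α : ℤ → Carrier) where
    eVars : ℤ → ℤ → List Carrier
    eVars i j = map (λ t → - α t) (range (i ℤ.+ + 1) ∣ j ℤ.- i ℤ.- + 1 ∣)

    hVars : ℤ → ℤ → List Carrier
    hVars i j = map α (range j ∣ i ℤ.- j ℤ.+ + 1 ∣)

    A : ℤ → ℤ → ℤ → Carrier
    A k i j with + 0 <? k
    ... | yes _ with i ℤ.+ k ≤? j
    ...   | yes _ = e ∣ j ℤ.- i ℤ.- k ∣ (eVars i j)
    ...   | no  _ = 0#
    A k i j | no _ with j ≤? i | i ≤? j ℤ.- k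
    ...   | yes _ | yes _ = h ∣ j ℤ.- i ℤ.- k ∣ (hVars i j)
    ...   | _     | _     = 0#

term : ∀ {c ℓ} (R : CommutativeRing c ℓ) → (ℤ → CommutativeRing.Carrier R) →
       ℤ → ℤ → ℤ → ℤ → ℤ → CommutativeRing.Carrier R
term R α k l p q a = CommutativeRing._*_ R (Symm.A R α k p a) (Symm.A R α l a q)

windowSum : ∀ {c ℓ} (R : CommutativeRing c ℓ) → (ℤ → CommutativeRing.Carrier R) →
            ℤ → ℤ → ℤ → ℤ → ℤ → ℕ → CommutativeRing.Carrier R
windowSum R α k l p q L n = Symm.sumOver R (range L n) (term R α k l p q)

-- For k, l > 0 each factor A^k_{p,a} is an elementary symmetric polynomial in the variables
-- -α_t strictly between its indices. Writing eᶜ_c for e_{N-c} on a list of length N, the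
-- identity becomes Σ_{xs = ys ++ z ∷ zs} eᶜ_{k-1}(ys) eᶜ_{l-1}(zs)
-- = eᶜ_{k+l-1}(xs): a sublist omitting k+l-1 entries of xs is cut at its k-th omitted entry z.
-- The summands vanish unless p < a < q, so every window containing [p, q] gives this sum.

module Submission where

open import Defs
open import Algebra.Bundles using (CommutativeRing)
open import Data.Nat using (ℕ)
open import Data.Integer using (ℤ; +_; _+_; _<_; _≤_)
open import Data.Sum using (_⊎_)
open import Data.Product using (_×_)

open import Level using (Level)
open import Function using (_∘_)
open import Data.Nat using (zero; suc; _∸_; z≤n; s≤s)
import Data.Nat as ℕ
import Data.Nat.Properties as ℕₚ
import Data.Integer as ℤ
import Data.Integer.Properties as ℤₚ
open import Data.Integer.Tactic.RingSolver using (solve-∀)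
open import Data.List using (List; []; _∷_; _++_; map; length)
open import Data.List.Properties using (length-map)
open import Data.List.Membership.Propositional using (_∈_)
open import Data.List.Relation.Unary.Any using (here; there)
open import Data.Product using (_,_; proj₁; proj₂; ∃-syntax)
open import Data.Sum using (inj₁; inj₂)
import Data.Sum as Sum
open import Relation.Nullary using (yes; no; contradiction)
open import Relation.Binary.PropositionalEquality as ≡ using (_≡_)

module _ where
  open ≡ using (refl; sym; trans; cong; subst; subst₂)

  private
    -i+[i+x]≡x : ∀ i x → ℤ.- i + (i + x) ≡ x
    -i+[i+x]≡x = solve-∀

    i+[j-i]≡j : ∀ i j → i + (j ℤ.- i) ≡ j
    i+[j-i]≡j = solve-∀

    [1+i]+x≡i+[1+x] : ∀ i x → (+ 1 + i) + x ≡ i + (+ 1 + x)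
    [1+i]+x≡i+[1+x] = solve-∀

    [i+x]-i-y≡x-y : ∀ i x y → (i + x) ℤ.- i ℤ.- y ≡ x ℤ.- y
    [i+x]-i-y≡x-y = solve-∀

  +-cancelˡ-≡ : ∀ i {j k} → i + j ≡ i + k → j ≡ k
  +-cancelˡ-≡ i {j} {k} eq = subst₂ _≡_ (-i+[i+x]≡x i j) (-i+[i+x]≡x i k) (cong (λ t → ℤ.- i + t) eq)

  +-cancelˡ-≤ : ∀ i {j k} → i + j ≤ i + k → j ≤ k
  +-cancelˡ-≤ i {j} {k} le = subst₂ _≤_ (-i+[i+x]≡x i j) (-i+[i+x]≡x i k) (ℤₚ.+-monoʳ-≤ (ℤ.- i) le)

  ≤⇒≡+ : ∀ {i j} → i ≤ j → ∃[ n ] j ≡ i + + n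
  ≤⇒≡+ {i} {j} i≤j =
    ℤ.∣ j ℤ.- i ∣ , sym (trans (cong (λ t → i + t) (ℤₚ.0≤i⇒+∣i∣≡i (ℤₚ.i≤j⇒0≤j-i i≤j))) (i+[j-i]≡j i j))

  <⇒≡+suc : ∀ {i j} → i < j → ∃[ n ] j ≡ i + + suc n
  <⇒≡+suc {i} i<j with ≤⇒≡+ (ℤₚ.i<j⇒suc[i]≤j i<j)
  ... | n , eq = n , trans eq ([1+i]+x≡i+[1+x] i (+ n))

  i<i+[1+n] : ∀ i n → i < i + + suc n
  i<i+[1+n] i n = subst (_< i + + suc n) (ℤₚ.+-identityʳ i) (ℤₚ.+-monoʳ-< i (ℤ.+<+ (s≤s z≤n)))

  ≤⇒<+[1+n] : ∀ {i j} n → i ≤ j → i < j + + suc n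
  ≤⇒<+[1+n] {j = j} n i≤j = ℤₚ.≤-<-trans i≤j (i<i+[1+n] j n)

  ∣[i+[1+m]]-i-[1+k]∣≡m∸k : ∀ i {m k} → k ℕ.≤ m → ℤ.∣ (i + + suc m) ℤ.- i ℤ.- + suc k ∣ ≡ m ∸ k
  ∣[i+[1+m]]-i-[1+k]∣≡m∸k i {m} {k} k≤m = cong ℤ.∣_∣
    (trans ([i+x]-i-y≡x-y i (+ suc m) (+ suc k)) (trans (ℤₚ.[1+m]⊖[1+n]≡m⊖n m k) (ℤₚ.⊖-≥ k≤m)))

  range-++ : ∀ s m n → range s (m ℕ.+ n) ≡ range s m ++ range (s + + m) n
  range-++ s zero    n = cong (λ t → range t n) (sym (ℤₚ.+-identityʳ s))
  range-++ s (suc m) n = cong (s ∷_) (trans (range-++ (s + + 1) m n)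
    (cong (λ t → range (s + + 1) m ++ range t n) (ℤₚ.+-assoc s (+ 1) (+ m))))

  length-range : ∀ s n → length (range s n) ≡ n
  length-range s zero    = refl
  length-range s (suc n) = cong suc (length-range (s + + 1) n)

  ∈-range⁻ : ∀ {a s n} → a ∈ range s n → ∃[ m ] m ℕ.< n × a ≡ s + + m
  ∈-range⁻ {s = s} {suc n} (here refl) = 0 , s≤s z≤n , sym (ℤₚ.+-identityʳ s)
  ∈-range⁻ {s = s} {suc n} (there a∈) with ∈-range⁻ a∈
  ... | m , m<n , refl = suc m , s≤s m<n , ℤₚ.+-assoc s (+ 1) (+ m)

  -- The integers strictly between i and j, provided i < j (otherwise junk, as ∣_∣
  -- truncates); eVars α i j is definitionally map (λ t → - α t) (between i j).
  between : ℤ → ℤ → List ℤ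
  between i j = range (i + + 1) ℤ.∣ j ℤ.- i ℤ.- + 1 ∣

  between-+ : ∀ i n → between i (i + + suc n) ≡ range (i + + 1) n
  between-+ i n = cong (range (i + + 1)) (∣[i+[1+m]]-i-[1+k]∣≡m∸k i z≤n)

  between-∷ : ∀ {i j} → i + + 1 < j → between i j ≡ (i + + 1) ∷ between (i + + 1) j
  between-∷ {i} i+1<j with <⇒≡+suc i+1<j
  ... | n , refl = trans (cong (between i) (ℤₚ.+-assoc i (+ 1) (+ suc n)))
    (trans (between-+ i (suc n)) (cong ((i + + 1) ∷_) (sym (between-+ (i + + 1) n))))

  ∈-between⁻ : ∀ {a i j} → i < j → a ∈ between i j → i < a × a < j
  ∈-between⁻ {i = i} i<j a∈ with <⇒≡+suc i<j
  ... | n , refl with ∈-range⁻ (subst (_ ∈_) (between-+ i n) a∈)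
  ...   | m , m<n , refl = subst (i <_) (sym (ℤₚ.+-assoc i (+ 1) (+ m))) (i<i+[1+n] i m)
                         , subst (_< i + + suc n) (sym (ℤₚ.+-assoc i (+ 1) (+ m)))
                             (ℤₚ.+-monoʳ-< i (ℤ.+<+ (s≤s m<n)))

module SymmetricPolynomials {c ℓ : Level} (R : CommutativeRing c ℓ) where
  open CommutativeRing R hiding (zero) renaming (_+_ to _⊕_)
  open Symm R
  open import Algebra.Properties.CommutativeSemigroup +-commutativeSemigroup using (interchange)
  open import Relation.Binary.Reasoning.Setoid setoid

  sumOver-++ : ∀ as bs f → sumOver (as ++ bs) f ≈ sumOver as f ⊕ sumOver bs f
  sumOver-++ []       bs f = sym (+-identityˡ _)
  sumOver-++ (a ∷ as) bs f = trans (+-congˡ (sumOver-++ as bs f)) (sym (+-assoc _ _ _))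

  sumOver-cong : ∀ as {f g} → (∀ {a} → a ∈ as → f a ≈ g a) → sumOver as f ≈ sumOver as g
  sumOver-cong []       f≈g = refl
  sumOver-cong (a ∷ as) f≈g = +-cong (f≈g (here ≡.refl)) (sumOver-cong as (f≈g ∘ there))

  sumOver-vanishes : ∀ as {f} → (∀ {a} → a ∈ as → f a ≈ 0#) → sumOver as f ≈ 0#
  sumOver-vanishes []       f≈0 = refl
  sumOver-vanishes (a ∷ as) f≈0 =
    trans (+-cong (f≈0 (here ≡.refl)) (sumOver-vanishes as (f≈0 ∘ there))) (+-identityˡ 0#)

  sumOver-window : ∀ {L i j n} f → L ≤ i → i < j → j < L + + n →
                   (∀ a → a ≤ i ⊎ j ≤ a → f a ≈ 0#) →
                   sumOver (range L n) f ≈ sumOver (between i j) f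
  sumOver-window {L} {n = n} f L≤i i<j j<L+n f≈0 with ≤⇒≡+ L≤i
  ... | d , ≡.refl with <⇒≡+suc i<j
  ... | N , ≡.refl with <⇒≡+suc j<L+n
  ... | r , L+n≡j+[1+r] = begin
    sumOver (range L n) f
      ≡⟨ ≡.cong (λ t → sumOver t f) range-split ⟩
    sumOver (range L d ++ i ∷ (range (i + + 1) N ++ range j (suc r))) f
      ≈⟨ trans (sumOver-++ (range L d) _ f) (+-congˡ (+-congˡ (sumOver-++ (range (i + + 1) N) _ f))) ⟩
    sumOver (range L d) f ⊕ (f i ⊕ (sumOver (range (i + + 1) N) f ⊕ sumOver (range j (suc r)) f))
      ≈⟨ +-cong (sumOver-vanishes _ below)
                (+-cong (f≈0 i (inj₁ ℤₚ.≤-refl)) (+-congˡ (sumOver-vanishes _ above))) ⟩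
    0# ⊕ (0# ⊕ (sumOver (range (i + + 1) N) f ⊕ 0#))
      ≈⟨ trans (+-identityˡ _) (trans (+-identityˡ _) (+-identityʳ _)) ⟩
    sumOver (range (i + + 1) N) f
      ≡⟨ ≡.cong (λ t → sumOver t f) (between-+ i N) ⟨
    sumOver (between i j) f ∎
    where
    i = L + + d
    j = i + + suc N
    n≡d+[[1+N]+[1+r]] : n ≡ d ℕ.+ (suc N ℕ.+ suc r)
    n≡d+[[1+N]+[1+r]] = ℤₚ.+-injective (+-cancelˡ-≡ L (≡.trans L+n≡j+[1+r]
      (≡.trans (ℤₚ.+-assoc i (+ suc N) (+ suc r)) (ℤₚ.+-assoc L (+ d) (+ (suc N ℕ.+ suc r))))))
    range-split : range L n ≡ range L d ++ i ∷ (range (i + + 1) N ++ range j (suc r))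
    range-split = ≡.trans (≡.cong (range L) n≡d+[[1+N]+[1+r]])
      (≡.trans (range-++ L d (suc N ℕ.+ suc r))
        (≡.cong (λ t → range L d ++ i ∷ t) (≡.trans (range-++ (i + + 1) N (suc r))
          (≡.cong (λ t → range (i + + 1) N ++ range t (suc r)) (ℤₚ.+-assoc i (+ 1) (+ N))))))
    below : ∀ {a} → a ∈ range L d → f a ≈ 0#
    below a∈ with ∈-range⁻ a∈
    ... | m , m<d , ≡.refl = f≈0 _ (inj₁ (ℤₚ.+-monoʳ-≤ L (ℤ.+≤+ (ℕₚ.<⇒≤ m<d))))
    above : ∀ {a} → a ∈ range j (suc r) → f a ≈ 0#
    above a∈ with ∈-range⁻ a∈
    ... | m , _ , ≡.refl = f≈0 _ (inj₂ (ℤₚ.i≤i+j j (+ m)))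

  e-vanishes : ∀ {r} xs → length xs ℕ.< r → e r xs ≈ 0#
  e-vanishes {suc r} []       _            = refl
  e-vanishes {suc r} (x ∷ xs) (s≤s |xs|<r) = begin
    e (suc r) xs ⊕ x * e r xs
      ≈⟨ +-cong (e-vanishes xs (ℕₚ.m<n⇒m<1+n |xs|<r)) (*-congˡ (e-vanishes xs |xs|<r)) ⟩
    0# ⊕ x * 0#
      ≈⟨ trans (+-identityˡ _) (zeroʳ x) ⟩
    0# ∎

  -- eᶜ c xs sums the products of the sublists of xs that omit exactly c entries.
  eᶜ : ℕ → List Carrier → Carrier
  eᶜ zero    []       = 1#
  eᶜ (suc c) []       = 0#
  eᶜ zero    (x ∷ xs) = x * eᶜ zero xs
  eᶜ (suc c) (x ∷ xs) = x * eᶜ (suc c) xs ⊕ eᶜ c xs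

  eᶜ-vanishes : ∀ {c} xs → length xs ℕ.< c → eᶜ c xs ≈ 0#
  eᶜ-vanishes {suc c} []       _            = refl
  eᶜ-vanishes {suc c} (x ∷ xs) (s≤s |xs|<c) = begin
    x * eᶜ (suc c) xs ⊕ eᶜ c xs
      ≈⟨ +-cong (*-congˡ (eᶜ-vanishes xs (ℕₚ.m<n⇒m<1+n |xs|<c))) (eᶜ-vanishes xs |xs|<c) ⟩
    x * 0# ⊕ 0#
      ≈⟨ trans (+-identityʳ _) (zeroʳ x) ⟩
    0# ∎

  eᶜ≈e : ∀ c r xs → c ℕ.+ r ≡ length xs → eᶜ c xs ≈ e r xs
  eᶜ≈e zero    zero    []       _      = refl
  eᶜ≈e zero    (suc r) (x ∷ xs) ≡.refl = begin
    x * eᶜ zero xs            ≈⟨ *-congˡ (eᶜ≈e zero r xs ≡.refl) ⟩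
    x * e r xs                ≈⟨ +-identityˡ _ ⟨
    0# ⊕ x * e r xs           ≈⟨ +-congʳ (e-vanishes xs (ℕₚ.n<1+n r)) ⟨
    e (suc r) xs ⊕ x * e r xs ∎
  eᶜ≈e (suc c) zero    (x ∷ xs) eq with ≡.trans (≡.sym (ℕₚ.+-identityʳ c)) (ℕₚ.suc-injective eq)
  ... | ≡.refl = begin
    x * eᶜ (suc c) xs ⊕ eᶜ c xs
      ≈⟨ +-cong (*-congˡ (eᶜ-vanishes xs (ℕₚ.n<1+n c))) (eᶜ≈e c zero xs (ℕₚ.+-identityʳ c)) ⟩
    x * 0# ⊕ 1#
      ≈⟨ trans (+-congʳ (zeroʳ x)) (+-identityˡ 1#) ⟩
    1# ∎
  eᶜ≈e (suc c) (suc r) (x ∷ xs) eq = begin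
    x * eᶜ (suc c) xs ⊕ eᶜ c xs
      ≈⟨ +-cong (*-congˡ (eᶜ≈e (suc c) r xs (≡.trans (≡.sym (ℕₚ.+-suc c r)) c+1+r≡|xs|)))
                (eᶜ≈e c (suc r) xs c+1+r≡|xs|) ⟩
    x * e r xs ⊕ e (suc r) xs
      ≈⟨ +-comm _ _ ⟩
    e (suc r) xs ⊕ x * e r xs ∎
    where
    c+1+r≡|xs| : c ℕ.+ suc r ≡ length xs
    c+1+r≡|xs| = ℕₚ.suc-injective eq

  -- splitSum F G xs is the sum of F ys * G zs over all decompositions xs = ys ++ z ∷ zs.
  splitSum : (List Carrier → Carrier) → (List Carrier → Carrier) → List Carrier → Carrier
  splitSum F G []       = 0#
  splitSum F G (x ∷ xs) = F [] * G xs ⊕ splitSum (F ∘ (x ∷_)) G xs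

  splitSum-+ : ∀ F F′ G xs → splitSum (λ ys → F ys ⊕ F′ ys) G xs ≈ splitSum F G xs ⊕ splitSum F′ G xs
  splitSum-+ F F′ G []       = sym (+-identityʳ 0#)
  splitSum-+ F F′ G (x ∷ xs) = begin
    (F [] ⊕ F′ []) * G xs ⊕ splitSum (λ ys → F (x ∷ ys) ⊕ F′ (x ∷ ys)) G xs
      ≈⟨ +-cong (distribʳ (G xs) (F []) (F′ [])) (splitSum-+ (F ∘ (x ∷_)) (F′ ∘ (x ∷_)) G xs) ⟩
    (F [] * G xs ⊕ F′ [] * G xs) ⊕ (splitSum (F ∘ (x ∷_)) G xs ⊕ splitSum (F′ ∘ (x ∷_)) G xs)
      ≈⟨ interchange _ _ _ _ ⟩
    splitSum F G (x ∷ xs) ⊕ splitSum F′ G (x ∷ xs) ∎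

  splitSum-* : ∀ y F G xs → splitSum (λ ys → y * F ys) G xs ≈ y * splitSum F G xs
  splitSum-* y F G []       = sym (zeroʳ y)
  splitSum-* y F G (x ∷ xs) = begin
    y * F [] * G xs ⊕ splitSum (λ ys → y * F (x ∷ ys)) G xs
      ≈⟨ +-cong (*-assoc y (F []) (G xs)) (splitSum-* y (F ∘ (x ∷_)) G xs) ⟩
    y * (F [] * G xs) ⊕ y * splitSum (F ∘ (x ∷_)) G xs
      ≈⟨ distribˡ y _ _ ⟨
    y * splitSum F G (x ∷ xs) ∎

  splitSum-eᶜ : ∀ c d xs → splitSum (eᶜ c) (eᶜ d) xs ≈ eᶜ (suc (c ℕ.+ d)) xs
  splitSum-eᶜ c       d []       = refl
  splitSum-eᶜ zero    d (x ∷ xs) = begin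
    1# * eᶜ d xs ⊕ splitSum (λ ys → x * eᶜ zero ys) (eᶜ d) xs
      ≈⟨ +-cong (*-identityˡ _) (splitSum-* x (eᶜ zero) (eᶜ d) xs) ⟩
    eᶜ d xs ⊕ x * splitSum (eᶜ zero) (eᶜ d) xs
      ≈⟨ +-congˡ (*-congˡ (splitSum-eᶜ zero d xs)) ⟩
    eᶜ d xs ⊕ x * eᶜ (suc d) xs
      ≈⟨ +-comm _ _ ⟩
    x * eᶜ (suc d) xs ⊕ eᶜ d xs ∎
  splitSum-eᶜ (suc c) d (x ∷ xs) = begin
    0# * eᶜ d xs ⊕ splitSum (λ ys → x * eᶜ (suc c) ys ⊕ eᶜ c ys) (eᶜ d) xs
      ≈⟨ trans (+-congʳ (zeroˡ _)) (+-identityˡ _) ⟩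
    splitSum (λ ys → x * eᶜ (suc c) ys ⊕ eᶜ c ys) (eᶜ d) xs
      ≈⟨ splitSum-+ (λ ys → x * eᶜ (suc c) ys) (eᶜ c) (eᶜ d) xs ⟩
    splitSum (λ ys → x * eᶜ (suc c) ys) (eᶜ d) xs ⊕ splitSum (eᶜ c) (eᶜ d) xs
      ≈⟨ +-cong (splitSum-* x (eᶜ (suc c)) (eᶜ d) xs) (splitSum-eᶜ c d xs) ⟩
    x * splitSum (eᶜ (suc c)) (eᶜ d) xs ⊕ eᶜ (suc (c ℕ.+ d)) xs
      ≈⟨ +-congʳ (*-congˡ (splitSum-eᶜ (suc c) d xs)) ⟩
    x * eᶜ (suc (suc c ℕ.+ d)) xs ⊕ eᶜ (suc (c ℕ.+ d)) xs ∎

  sumOver-between≈splitSum : ∀ (x : ℤ → Carrier) F G {i j} → i < j →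
    sumOver (between i j) (λ a → F (map x (between i a)) * G (map x (between a j)))
      ≈ splitSum F G (map x (between i j))
  sumOver-between≈splitSum x F G {i} {j} i<j = go _ F i (proj₂ (<⇒≡+suc i<j))
    where
    go : ∀ n F i → j ≡ i + + suc n →
      sumOver (between i j) (λ a → F (map x (between i a)) * G (map x (between a j)))
        ≈ splitSum F G (map x (between i j))
    go zero    F i j≡i+1 rewrite j≡i+1 | between-+ i 0 = refl
    go (suc n) F i j≡i+[2+n] = begin
      sumOver (between i j) summand
        ≡⟨ ≡.cong (λ t → sumOver t summand) (between-∷ i′<j) ⟩
      summand i′ ⊕ sumOver (between i′ j) summand
        ≈⟨ +-cong head tail ⟩
      F [] * G (map x (between i′ j)) ⊕ splitSum (F ∘ (x i′ ∷_)) G (map x (between i′ j))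
        ≡⟨ ≡.cong (λ t → splitSum F G (map x t)) (between-∷ i′<j) ⟨
      splitSum F G (map x (between i j)) ∎
      where
      i′ = i + + 1
      summand : ℤ → Carrier
      summand a = F (map x (between i a)) * G (map x (between a j))
      j≡i′+[1+n] : j ≡ i′ + + suc n
      j≡i′+[1+n] = ≡.trans j≡i+[2+n] (≡.sym (ℤₚ.+-assoc i (+ 1) (+ suc n)))
      i′<j : i′ < j
      i′<j = ≡.subst (i′ <_) (≡.sym j≡i′+[1+n]) (i<i+[1+n] i′ n)
      head : summand i′ ≈ F [] * G (map x (between i′ j))
      head = reflexive (≡.cong (λ t → F (map x t) * G (map x (between i′ j))) (between-+ i 0))
      tail : sumOver (between i′ j) summand ≈ splitSum (F ∘ (x i′ ∷_)) G (map x (between i′ j))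
      tail = trans
        (sumOver-cong (between i′ j) λ a∈ →
          reflexive (≡.cong (λ t → F (map x t) * G (map x (between _ j)))
                            (between-∷ (proj₁ (∈-between⁻ i′<j a∈)))))
        (go n (F ∘ (x i′ ∷_)) i′ j≡i′+[1+n])

  module _ (α : ℤ → Carrier) where

    A-vanishes : ∀ {k i j} → + 0 < k → j < i + k → A α k i j ≈ 0#
    A-vanishes {k} {i} {j} 0<k j<i+k with + 0 ℤ.<? k
    ... | no 0≮k = contradiction 0<k 0≮k
    ... | yes _ with i + k ℤ.≤? j
    ...   | yes i+k≤j = contradiction j<i+k (ℤₚ.≤⇒≯ i+k≤j)
    ...   | no _      = refl

    length-eVars : ∀ i m → length (eVars α i (i + + suc m)) ≡ m
    length-eVars i m = ≡.trans (length-map (λ t → - α t) (between i (i + + suc m)))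
      (≡.trans (≡.cong length (between-+ i m)) (length-range (i + + 1) m))

    A-suc : ∀ k {i j} → i < j → A α (+ suc k) i j ≈ eᶜ k (eVars α i j)
    A-suc k {i} i<j with <⇒≡+suc i<j
    ... | m , ≡.refl with + 0 ℤ.<? + suc k
    ...   | no 0≮1+k = contradiction (ℤ.+<+ (s≤s z≤n)) 0≮1+k
    ...   | yes _ with i + + suc k ℤ.≤? i + + suc m
    ...     | yes le = sym (eᶜ≈e k _ (eVars α i (i + + suc m))
                         (≡.trans (≡.cong (k ℕ.+_) (∣[i+[1+m]]-i-[1+k]∣≡m∸k i k≤m))
                           (≡.trans (ℕₚ.m+[n∸m]≡n k≤m) (≡.sym (length-eVars i m)))))
      where
      k≤m : k ℕ.≤ m
      k≤m = ℕₚ.≤-pred (ℤₚ.drop‿+≤+ (+-cancelˡ-≤ i le))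
    ...     | no ¬le = sym (eᶜ-vanishes _ (≡.subst (ℕ._< k) (≡.sym (length-eVars i m)) m<k))
      where
      m<k : m ℕ.< k
      m<k = ℕₚ.≰⇒> (λ k≤m → ¬le (ℤₚ.+-monoʳ-≤ i (ℤ.+≤+ (s≤s k≤m))))

    term-vanishes : ∀ k l {p q a} → a ≤ p ⊎ q ≤ a → term R α (+ suc k) (+ suc l) p q a ≈ 0#
    term-vanishes k l {p} {q} {a} (inj₁ a≤p) =
      trans (*-congʳ (A-vanishes {i = p} (ℤ.+<+ (s≤s z≤n)) (≤⇒<+[1+n] k a≤p))) (zeroˡ _)
    term-vanishes k l {p} {q} {a} (inj₂ q≤a) =
      trans (*-congˡ (A-vanishes {i = a} (ℤ.+<+ (s≤s z≤n)) (≤⇒<+[1+n] l q≤a))) (zeroʳ _)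

    sumOver-between-term≈A : ∀ k l {p q} → p < q →
      sumOver (between p q) (term R α (+ suc k) (+ suc l) p q) ≈ A α (+ suc k + + suc l) p q
    sumOver-between-term≈A k l {p} {q} p<q = begin
      sumOver (between p q) (term R α (+ suc k) (+ suc l) p q)
        ≈⟨ sumOver-cong (between p q) (λ a∈ → let p<a , a<q = ∈-between⁻ p<q a∈ in
                                               *-cong (A-suc k p<a) (A-suc l a<q)) ⟩
      sumOver (between p q) (λ a → eᶜ k (eVars α p a) * eᶜ l (eVars α a q))
        ≈⟨ sumOver-between≈splitSum (λ t → - α t) (eᶜ k) (eᶜ l) p<q ⟩
      splitSum (eᶜ k) (eᶜ l) (eVars α p q)
        ≈⟨ splitSum-eᶜ k l (eVars α p q) ⟩
      eᶜ (suc (k ℕ.+ l)) (eVars α p q)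
        ≡⟨ ≡.cong (λ c → eᶜ c (eVars α p q)) (ℕₚ.+-suc k l) ⟨
      eᶜ (k ℕ.+ suc l) (eVars α p q)
        ≈⟨ A-suc (k ℕ.+ suc l) p<q ⟨
      A α (+ suc k + + suc l) p q ∎

lemma3p2 : ∀ {c ℓ} (R : CommutativeRing c ℓ) (α : ℤ → CommutativeRing.Carrier R)
    (k l : ℤ) → + 0 < k → + 0 < l → (p q : ℤ) →
    (∀ a → a < p ⊎ q < a →
      CommutativeRing._≈_ R (term R α k l p q a) (CommutativeRing.0# R))
    ×
    (∀ (L : ℤ) (n : ℕ) → L ≤ p → q < L + + n →
      CommutativeRing._≈_ R (windowSum R α k l p q L n) (Symm.A R α (k + l) p q))
lemma3p2 R α (+ suc k) (+ suc l) _ _ p q = outside , window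
  where
  open CommutativeRing R using (_≈_; 0#; trans; sym)
  open Symm R using (A)
  open SymmetricPolynomials R

  outside : ∀ a → a < p ⊎ q < a → term R α (+ suc k) (+ suc l) p q a ≈ 0#
  outside a = term-vanishes α k l ∘ Sum.map ℤₚ.<⇒≤ ℤₚ.<⇒≤

  window : ∀ L n → L ≤ p → q < L + + n →
           windowSum R α (+ suc k) (+ suc l) p q L n ≈ A α (+ suc k + + suc l) p q
  window L n L≤p q<L+n with p ℤ.<? q
  ... | yes p<q = trans (sumOver-window _ L≤p p<q q<L+n (λ a → term-vanishes α k l))
                        (sumOver-between-term≈A α k l p<q)
  ... | no p≮q  = trans (sumOver-vanishes (range L n) (λ {a} _ → term-vanishes α k l (≤-or-≥ a)))
                        (sym (A-vanishes α {i = p} (ℤ.+<+ (s≤s z≤n)) (≤⇒<+[1+n] (k ℕ.+ suc l) q≤p)))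
    where
    q≤p : q ≤ p
    q≤p = ℤₚ.≮⇒≥ p≮q
    ≤-or-≥ : ∀ a → a ≤ p ⊎ q ≤ a
    ≤-or-≥ a with a ℤ.≤? p
    ... | yes a≤p = inj₁ a≤p
    ... | no a≰p  = inj₂ (ℤₚ.≤-trans q≤p (ℤₚ.<⇒≤ (ℤₚ.≰⇒> a≰p)))
lemma3p2 R α (+ zero)   _          (ℤ.+<+ ()) _          p q
lemma3p2 R α ℤ.-[1+ _ ] _          ()         _          p q
lemma3p2 R α _          (+ zero)   _          (ℤ.+<+ ()) p q
lemma3p2 R α _          ℤ.-[1+ _ ] _          ()         p q
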